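{- For every integer $s\ge 2$, the graph $K_{1,s}\times P_3$ is antimagic.
   Context: $K_{1,s}$ denotes the star with one center and $s$ leaves, and $P_n$ denotes the path on $n$ vertices. For graphs $G$ and $H$, the direct product $G\times H$ has vertex set $V(G)\times V(H)$, with $(x,y)$ adjacent to $(x',y')$ if and only if $xx'\in E(G)$ and $yy'\in E(H)$. A (possibly disconnected) graph $G$ is antimagic if there is a bijection $f:E(G)\to\{1,2,\dots,|E(G)|\}$ such that the vertex sums $\sum_{e\ni v} f(e)$ are pairwise distinct over all vertices $v$ of $G$. -}

module Defs where

open import Data.Nat using (ℕ; zero; suc; _+_; _*_)
open import Data.Bool using (Bool; true; false; _∧_; _∨_; not; if_then_else_)
open import Data.Fin using (Fin; zero; suc; toℕ; remQuot; _<_)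
open import Data.Fin.Properties using (_≟_)
open import Data.Product using (Σ; _×_; _,_; proj₁; proj₂)
open import Relation.Nullary.Decidable using (⌊_⌋)
open import Relation.Binary.PropositionalEquality using (_≡_)
open import Function.Bundles using (_↔_; Inverse)
open import Function.Definitions using (Injective)

-- A finite simple graph on the vertex set Fin n, given by a Boolean
-- adjacency function (all graphs built below have a symmetric,
-- irreflexive adjacency).
record Graph : Set where
  field
    n   : ℕ
    adj : Fin n → Fin n → Bool
open Graph public

Edge : (G : Graph) → Set
Edge G = Σ (Fin (n G) × Fin (n G)) λ p → (proj₁ p < proj₂ p) × (adj G (proj₁ p) (proj₂ p) ≡ true)

incident : (G : Graph) → Fin (n G) → Edge G → Bool
incident G v ((i , j) , _) = ⌊ i ≟ v ⌋ ∨ ⌊ j ≟ v ⌋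

sumFin : (m : ℕ) → (Fin m → ℕ) → ℕ
sumFin zero    f = 0
sumFin (suc m) f = f zero + sumFin m (λ k → f (suc k))

-- Given a bijection f : E(G) → Fin m (edge e gets label toℕ (f e) + 1,
-- so labels are exactly 1..m), the vertex sum at v is the sum of the
-- labels k+1 of the edges f⁻¹(k) incident to v.
vertexSum : (G : Graph) (m : ℕ) → Edge G ↔ Fin m → Fin (n G) → ℕ
vertexSum G m f v =
  sumFin m (λ k → if incident G v (Inverse.from f k) then suc (toℕ k) else 0)

-- G is antimagic: there is a bijection E(G) → {1,…,|E(G)|} whose vertex
-- sums are pairwise distinct.  (A bijection E(G) ↔ Fin m forces m = |E(G)|.)
Antimagic : Graph → Set
Antimagic G = Σ ℕ λ m → Σ (Edge G ↔ Fin m) λ f → Injective _≡_ _≡_ (vertexSum G m f)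

isZero : ∀ {k} → Fin k → Bool
isZero zero    = true
isZero (suc _) = false

Star : ℕ → Graph
Star s = record { n = suc s ; adj = λ i j → (isZero i ∧ not (isZero j)) ∨ (isZero j ∧ not (isZero i)) }

Path : ℕ → Graph
Path k = record { n = k ; adj = λ i j → ⌊ suc (toℕ i) Data.Nat.≟ toℕ j ⌋ ∨ ⌊ suc (toℕ j) Data.Nat.≟ toℕ i ⌋ }
  where import Data.Nat

_×ᵍ_ : Graph → Graph → Graph
G ×ᵍ H = record
  { n   = n G * n H
  ; adj = λ a b → let (x , y)   = remQuot (n H) a
                      (x' , y') = remQuot (n H) b
                  in adj G x x' ∧ adj H y y'
  }

-- Every edge of K₁,ₛ × H joins a hub vertex (0, y) to a leaf vertex (l, y') along an
-- arc (y, y') of H, so the edges of K₁,ₛ × P₃ are the pairs (l, c) with c indexing the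
-- four arcs (1,0), (0,1), (1,2), (2,1) of P₃; label (l, c) by 4l + c + 1.  The leaf sums
-- are then 4l + 1, 8l + 6 and 4l + 3, told apart by their residues 1, 2, 3 mod 4; the hub
-- sums 2s², 4s² and 2s² + 2s are distinct for s ≥ 2; and every leaf sum lies below
-- 8s ≤ 2s², the smallest hub sum, once s ≥ 4.  The cases s = 2, 3 are checked by computation.

module Submission where

open import Defs
open import Data.Nat using (ℕ; zero; suc; _+_; _*_; _≤_; _<_; _%_; NonZero; z≤n; s≤s; z<s)
open import Data.Nat.Properties
  using (+-assoc; +-comm; *-zeroʳ; *-distribˡ-+; *-assoc; suc-injective; +-cancelˡ-≡; *-cancelʳ-≡; *-cancelˡ-≡;
         *-comm; ≤-refl; <-trans; <⇒≢; >⇒≢; m≤m+n; m<m+n; m<m*n; +-monoʳ-<; *-monoʳ-<; *-monoʳ-≤; *-monoˡ-≤;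
         module ≤-Reasoning)
  renaming (_≟_ to _≟ℕ_)
open import Data.Nat.DivMod using ([m+kn]%n≡m%n)
open import Data.Nat.Tactic.RingSolver using (solve-∀)
open import Data.Bool using (Bool; true; false; _∧_; _∨_; if_then_else_)
open import Data.Bool.Properties using (∨-identityʳ) renaming (_≟_ to _≟ᵇ_)
open import Data.Fin.Patterns using (0F; 1F; 2F; 3F)
open import Data.Fin as Fin using (Fin; zero; suc; toℕ; combine; _↑ˡ_; _↑ʳ_)
open import Data.Fin.Properties
  using (_≟_; remQuot-combine; toℕ-combine; combine-injective; combine-surjective;
         combine-monoˡ-<; <-asym; <-irrelevant; *↔×;
         toℕ<n; toℕ-injective; all?)
open import Function.Base using (_∘_)
open import Data.Product using (Σ; _×_; _,_; proj₁; proj₂; ∃; uncurry)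
open import Data.Product.Function.NonDependent.Propositional using (_×-↔_)
open import Data.Empty using (⊥-elim)
open import Relation.Nullary.Negation using (contradiction)
open import Relation.Nullary using (Dec; ¬?)
open import Relation.Nullary.Decidable using (⌊_⌋; yes; no; from-yes)
open import Relation.Binary.PropositionalEquality
  using (_≡_; _≢_; refl; sym; trans; cong; cong₂; module ≡-Reasoning)
open import Function.Bundles using (_↔_; Inverse; mk⤖; mk↔ₛ′)
open import Function.Definitions using (Injective; StrictlySurjective)
open import Function.Consequences.Propositional using (strictlySurjective⇒surjective)
open import Function.Properties.Bijection using (⤖⇒↔)
open import Function.Properties.Inverse using (↔-refl; ↔-sym; ↔-trans)
open import Axiom.UniquenessOfIdentityProofs using (module Decidable⇒UIP)

m+k≡n⇒m≤n : ∀ {m n} k → m + k ≡ n → m ≤ n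
m+k≡n⇒m≤n {m} k refl = m≤m+n m k

m+kn≡o+ln⇒m%n≡o%n : ∀ m k o l n .{{_ : NonZero n}} → m + k * n ≡ o + l * n → m % n ≡ o % n
m+kn≡o+ln⇒m%n≡o%n m k o l n eq =
  trans (sym ([m+kn]%n≡m%n m k n)) (trans (cong (_% n) eq) ([m+kn]%n≡m%n o l n))

sumFin-cong : ∀ m {f g : Fin m → ℕ} → (∀ i → f i ≡ g i) → sumFin m f ≡ sumFin m g
sumFin-cong zero    f≡g = refl
sumFin-cong (suc m) f≡g = cong₂ _+_ (f≡g zero) (sumFin-cong m (λ i → f≡g (suc i)))

sumFin-+ : ∀ m (f g : Fin m → ℕ) → sumFin m (λ i → f i + g i) ≡ sumFin m f + sumFin m g
sumFin-+ zero    f g = refl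
sumFin-+ (suc m) f g = begin
  f zero + g zero + sumFin m (λ i → f (suc i) + g (suc i))
    ≡⟨ cong (f zero + g zero +_) (sumFin-+ m (λ i → f (suc i)) (λ i → g (suc i))) ⟩
  f zero + g zero + (sumFin m (λ i → f (suc i)) + sumFin m (λ i → g (suc i)))
    ≡⟨ shuffle (f zero) (g zero) _ _ ⟩
  f zero + sumFin m (λ i → f (suc i)) + (g zero + sumFin m (λ i → g (suc i))) ∎
  where
  open ≡-Reasoning
  shuffle : ∀ a b c d → a + b + (c + d) ≡ a + c + (b + d)
  shuffle = solve-∀

sumFin-* : ∀ m k (f : Fin m → ℕ) → sumFin m (λ i → k * f i) ≡ k * sumFin m f
sumFin-* zero    k f = sym (*-zeroʳ k)
sumFin-* (suc m) k f = trans (cong (k * f zero +_) (sumFin-* m k (λ i → f (suc i))))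
                             (sym (*-distribˡ-+ k (f zero) _))

sumFin-const : ∀ m c → sumFin m (λ _ → c) ≡ m * c
sumFin-const zero    c = refl
sumFin-const (suc m) c = cong (c +_) (sumFin-const m c)

sumFin-zero : ∀ m → sumFin m (λ _ → 0) ≡ 0
sumFin-zero m = trans (sumFin-const m 0) (*-zeroʳ m)

sumFin-↑ : ∀ m n (f : Fin (m + n) → ℕ) →
           sumFin (m + n) f ≡ sumFin m (λ i → f (i ↑ˡ n)) + sumFin n (λ j → f (m ↑ʳ j))
sumFin-↑ zero    n f = refl
sumFin-↑ (suc m) n f = trans (cong (f zero +_) (sumFin-↑ m n (λ i → f (suc i))))
                             (sym (+-assoc (f zero) _ _))

sumFin-combine : ∀ m n (f : Fin (m * n) → ℕ) →
                 sumFin (m * n) f ≡ sumFin m (λ i → sumFin n (λ j → f (combine i j)))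
sumFin-combine zero    n f = refl
sumFin-combine (suc m) n f = trans (sumFin-↑ n (m * n) f)
  (cong (sumFin n (λ j → f (j ↑ˡ (m * n))) +_) (sumFin-combine m n (λ k → f (n ↑ʳ k))))

sumFin-if-∧ : ∀ m b (c : Fin m → Bool) (f : Fin m → ℕ) →
              sumFin m (λ i → if b ∧ c i then f i else 0) ≡
              (if b then sumFin m (λ i → if c i then f i else 0) else 0)
sumFin-if-∧ m true  c f = refl
sumFin-if-∧ m false c f = sumFin-zero m

-- Not definitional: ⌊_⌋ does not compute through the map′ in the definition of _≟_.
⌊suc≟suc⌋ : ∀ {m} (i j : Fin m) → ⌊ suc i ≟ suc j ⌋ ≡ ⌊ i ≟ j ⌋
⌊suc≟suc⌋ i j with i ≟ j
... | yes _ = refl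
... | no  _ = refl

sumFin-if-≟ : ∀ m (i : Fin m) (f : Fin m → ℕ) → sumFin m (λ j → if ⌊ j ≟ i ⌋ then f j else 0) ≡ f i
sumFin-if-≟ (suc m) zero    f = begin
  f zero + sumFin m (λ _ → 0) ≡⟨ cong (f zero +_) (sumFin-zero m) ⟩
  f zero + 0                  ≡⟨ +-comm (f zero) 0 ⟩
  f zero                      ∎
  where open ≡-Reasoning
sumFin-if-≟ (suc m) (suc i) f =
  trans (sumFin-cong m (λ j → cong (if_then f (suc j) else 0) (⌊suc≟suc⌋ j i)))
        (sumFin-if-≟ m i (λ j → f (suc j)))

sumFin-odd : ∀ m → sumFin m (λ i → 1 + 2 * toℕ i) ≡ m * m
sumFin-odd zero    = refl
sumFin-odd (suc m) = begin
  1 + sumFin m (λ i → 1 + 2 * suc (toℕ i))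
    ≡⟨ cong (1 +_) (sumFin-cong m (λ i → next (toℕ i))) ⟩
  1 + sumFin m (λ i → (1 + 2 * toℕ i) + 2)
    ≡⟨ cong (1 +_) (sumFin-+ m _ _) ⟩
  1 + (sumFin m (λ i → 1 + 2 * toℕ i) + sumFin m (λ _ → 2))
    ≡⟨ cong (λ x → 1 + (x + sumFin m (λ _ → 2))) (sumFin-odd m) ⟩
  1 + (m * m + sumFin m (λ _ → 2))
    ≡⟨ cong (λ x → 1 + (m * m + x)) (sumFin-const m 2) ⟩
  1 + (m * m + m * 2)
    ≡⟨ square m ⟩
  suc m * suc m ∎
  where
  open ≡-Reasoning
  next : ∀ k → 1 + 2 * suc k ≡ (1 + 2 * k) + 2
  next = solve-∀
  square : ∀ m → 1 + (m * m + m * 2) ≡ suc m * suc m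
  square = solve-∀

sumFin-*-odd : ∀ m k → sumFin m (λ i → k * (1 + 2 * toℕ i)) ≡ k * (m * m)
sumFin-*-odd m k = trans (sumFin-* m k _) (cong (k *_) (sumFin-odd m))

Bool-≡-irrelevant : ∀ {b c : Bool} (p q : b ≡ c) → p ≡ q
Bool-≡-irrelevant = Decidable⇒UIP.≡-irrelevant _≟ᵇ_

Edge-≡ : (G : Graph) {e e' : Edge G} → proj₁ e ≡ proj₁ e' → e ≡ e'
Edge-≡ G {(i , j) , i<j , ij} {(.i , .j) , i<j' , ij'} refl =
  cong₂ (λ p q → (i , j) , p , q) (<-irrelevant i<j i<j') (Bool-≡-irrelevant ij ij')

combine-≟ : ∀ {m n} (i k : Fin m) (j l : Fin n) →
            ⌊ combine i j ≟ combine k l ⌋ ≡ ⌊ i ≟ k ⌋ ∧ ⌊ j ≟ l ⌋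
combine-≟ i k j l with combine i j ≟ combine k l | i ≟ k | j ≟ l
... | yes _   | yes _    | yes _    = refl
... | yes eq  | no  i≢k  | _        = ⊥-elim (i≢k (proj₁ (combine-injective i j k l eq)))
... | yes eq  | yes _    | no  j≢l  = ⊥-elim (j≢l (proj₂ (combine-injective i j k l eq)))
... | no  neq | yes refl | yes refl = ⊥-elim (neq refl)
... | no  _   | yes _    | no  _    = refl
... | no  _   | no  _    | _        = refl

injective-via-combine : ∀ {m n} {A : Set} (f : Fin (m * n) → A) (g : Fin m → Fin n → A) →
                        (∀ x y → f (combine x y) ≡ g x y) →
                        (∀ {x y x' y'} → g x y ≡ g x' y' → x ≡ x' × y ≡ y') →
                        Injective _≡_ _≡_ f
injective-via-combine {m} {n} f g f≡g g-injective {v} {w} eq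
  with combine-surjective {m} {n} v | combine-surjective {m} {n} w
... | x , y , refl | x' , y' , refl
  with g-injective (trans (sym (f≡g x y)) (trans eq (f≡g x' y')))
... | refl , refl = refl

adj-×ᵍ : (G H : Graph) (x x' : Fin (n G)) (y y' : Fin (n H)) →
         adj (G ×ᵍ H) (combine x y) (combine x' y') ≡ (adj G x x' ∧ adj H y y')
adj-×ᵍ G H x x' y y' =
  cong₂ (λ p q → adj G (proj₁ p) (proj₁ q) ∧ adj H (proj₂ p) (proj₂ q))
        (remQuot-combine x y) (remQuot-combine x' y')

Arc : Graph → Set
Arc H = Σ (Fin (n H) × Fin (n H)) λ p → adj H (proj₁ p) (proj₂ p) ≡ true

source target : ∀ {H} → Arc H → Fin (n H)
source = proj₁ ∘ proj₁
target = proj₂ ∘ proj₁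

module _ (s : ℕ) (H : Graph) where

  hub : Fin (n H) → Fin (n (Star s ×ᵍ H))
  hub y = combine {suc s} {n H} zero y

  leaf : Fin s → Fin (n H) → Fin (n (Star s ×ᵍ H))
  leaf l y = combine {suc s} {n H} (suc l) y

  hub<leaf : ∀ y l y' → hub y Fin.< leaf l y'
  hub<leaf y l y' = combine-monoˡ-< {i = zero} {j = suc l} y y' z<s

  starEdge : Fin s → Arc H → Edge (Star s ×ᵍ H)
  starEdge l ((y , y') , yy') =
    (hub y , leaf l y') , hub<leaf y l y' , trans (adj-×ᵍ (Star s) H zero (suc l) y y') yy'

  starEdge-injective : Injective _≡_ _≡_ (uncurry starEdge)
  starEdge-injective {l , (y , y') , yy'} {l' , (z , z') , zz'} eq
    with combine-injective {m = suc s} zero y zero z (cong (proj₁ ∘ proj₁) eq)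
       | combine-injective {m = suc s} (suc l) y' (suc l') z' (cong (proj₂ ∘ proj₁) eq)
  ... | _ , refl | refl , refl = cong (λ q → l , (y , y') , q) (Bool-≡-irrelevant yy' zz')

  starEdge-surjective : StrictlySurjective _≡_ (uncurry starEdge)
  starEdge-surjective ((i , j) , i<j , ij)
    with combine-surjective {suc s} {n H} i | combine-surjective {suc s} {n H} j
  ... | x , y , refl | x' , y' , refl =
    cover x y x' y' i<j ij (trans (sym (adj-×ᵍ (Star s) H x x' y y')) ij)
    where
    cover : ∀ x y x' y' i<j ij → adj (Star s) x x' ∧ adj H y y' ≡ true →
            ∃ λ p → uncurry starEdge p ≡ ((combine x y , combine x' y') , i<j , ij)
    cover zero    y zero     y' i<j ij ()
    cover zero    y (suc l)  y' i<j ij yy' = (l , (y , y') , yy') , Edge-≡ (Star s ×ᵍ H) refl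
    cover (suc l) y zero     y' i<j ij _   = ⊥-elim (<-asym i<j (hub<leaf y' l y))
    cover (suc l) y (suc l') y' i<j ij ()

  starEdges : Edge (Star s ×ᵍ H) ↔ (Fin s × Arc H)
  starEdges = ↔-sym (⤖⇒↔ (mk⤖ (starEdge-injective , strictlySurjective⇒surjective starEdge-surjective)))

  starLabelling : ∀ {a} → Arc H ↔ Fin a → Edge (Star s ×ᵍ H) ↔ Fin (s * a)
  starLabelling α = ↔-trans starEdges (↔-trans (↔-refl ×-↔ α) (↔-sym *↔×))

  incident-starEdge : ∀ x y l (e : Arc H) →
                      incident (Star s ×ᵍ H) (combine x y) (starEdge l e) ≡
                      (⌊ zero ≟ x ⌋ ∧ ⌊ source e ≟ y ⌋) ∨ (⌊ suc l ≟ x ⌋ ∧ ⌊ target e ≟ y ⌋)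
  incident-starEdge x y l e = cong₂ _∨_ (combine-≟ zero x (source e) y) (combine-≟ (suc l) x (target e) y)

  module _ {a} (α : Arc H ↔ Fin a) where

    open Inverse α using (from)

    vertexSum-starLabelling : ∀ v →
      vertexSum (Star s ×ᵍ H) (s * a) (starLabelling α) v ≡
      sumFin s (λ l → sumFin a (λ c →
        if incident (Star s ×ᵍ H) v (starEdge l (from c)) then suc (toℕ c + a * toℕ l) else 0))
    vertexSum-starLabelling v = trans (sumFin-combine s a _) (sumFin-cong s λ l → sumFin-cong a λ c →
      cong₂ (λ p k → if incident (Star s ×ᵍ H) v (starEdge (proj₁ p) (from (proj₂ p))) then suc k else 0)
            (remQuot-combine l c) (trans (toℕ-combine l c) (+-comm (a * toℕ l) (toℕ c))))

    vertexSum-hub : ∀ y →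
      vertexSum (Star s ×ᵍ H) (s * a) (starLabelling α) (hub y) ≡
      sumFin s (λ l → sumFin a (λ c → if ⌊ source (from c) ≟ y ⌋ then suc (toℕ c + a * toℕ l) else 0))
    vertexSum-hub y = trans (vertexSum-starLabelling (hub y)) (sumFin-cong s λ l → sumFin-cong a λ c →
      cong (if_then _ else 0) (trans (incident-starEdge zero y l (from c)) (∨-identityʳ _)))

    vertexSum-leaf : ∀ l y →
      vertexSum (Star s ×ᵍ H) (s * a) (starLabelling α) (leaf l y) ≡
      sumFin a (λ c → if ⌊ target (from c) ≟ y ⌋ then suc (toℕ c + a * toℕ l) else 0)
    vertexSum-leaf l y = begin
      vertexSum (Star s ×ᵍ H) (s * a) (starLabelling α) (leaf l y)
        ≡⟨ vertexSum-starLabelling (leaf l y) ⟩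
      sumFin s (λ k → sumFin a (λ c → if incident (Star s ×ᵍ H) (leaf l y) (starEdge k (from c)) then label k c else 0))
        ≡⟨ sumFin-cong s (λ k → sumFin-cong a λ c → cong (if_then label k c else 0)
             (trans (incident-starEdge (suc l) y k (from c)) (cong (_∧ ⌊ target (from c) ≟ y ⌋) (⌊suc≟suc⌋ k l)))) ⟩
      sumFin s (λ k → sumFin a (λ c → if ⌊ k ≟ l ⌋ ∧ ⌊ target (from c) ≟ y ⌋ then label k c else 0))
        ≡⟨ sumFin-cong s (λ k → sumFin-if-∧ a ⌊ k ≟ l ⌋ _ (label k)) ⟩
      sumFin s (λ k → if ⌊ k ≟ l ⌋ then sumFin a (λ c → if ⌊ target (from c) ≟ y ⌋ then label k c else 0) else 0)
        ≡⟨ sumFin-if-≟ s l _ ⟩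
      sumFin a (λ c → if ⌊ target (from c) ≟ y ⌋ then label l c else 0) ∎
      where
      open ≡-Reasoning
      label : Fin s → Fin a → ℕ
      label k c = suc (toℕ c + a * toℕ k)

pathArc : Fin 4 → Arc (Path 3)
pathArc 0F = (1F , 0F) , refl
pathArc 1F = (0F , 1F) , refl
pathArc 2F = (1F , 2F) , refl
pathArc 3F = (2F , 1F) , refl

pathArcIndex : Arc (Path 3) → Fin 4
pathArcIndex ((0F , 0F) , ())
pathArcIndex ((0F , 1F) , _) = 1F
pathArcIndex ((0F , 2F) , ())
pathArcIndex ((1F , 0F) , _) = 0F
pathArcIndex ((1F , 1F) , ())
pathArcIndex ((1F , 2F) , _) = 2F
pathArcIndex ((2F , 0F) , ())
pathArcIndex ((2F , 1F) , _) = 3F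
pathArcIndex ((2F , 2F) , ())

pathArcs : Arc (Path 3) ↔ Fin 4
pathArcs = mk↔ₛ′ pathArcIndex pathArc index-pathArc pathArc-index
  where
  index-pathArc : ∀ c → pathArcIndex (pathArc c) ≡ c
  index-pathArc 0F = refl
  index-pathArc 1F = refl
  index-pathArc 2F = refl
  index-pathArc 3F = refl

  pathArc-index : ∀ e → pathArc (pathArcIndex e) ≡ e
  pathArc-index ((0F , 0F) , ())
  pathArc-index ((0F , 1F) , q) = cong (_ ,_) (Bool-≡-irrelevant refl q)
  pathArc-index ((0F , 2F) , ())
  pathArc-index ((1F , 0F) , q) = cong (_ ,_) (Bool-≡-irrelevant refl q)
  pathArc-index ((1F , 1F) , ())
  pathArc-index ((1F , 2F) , q) = cong (_ ,_) (Bool-≡-irrelevant refl q)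
  pathArc-index ((2F , 0F) , ())
  pathArc-index ((2F , 1F) , q) = cong (_ ,_) (Bool-≡-irrelevant refl q)
  pathArc-index ((2F , 2F) , ())

hubSum : ℕ → Fin 3 → ℕ
hubSum s 0F = 2 * (s * s)
hubSum s 1F = 4 * (s * s)
hubSum s 2F = 2 * (s * s) + s * 2

leafSum : ℕ → Fin 3 → ℕ
leafSum l 0F = 1 + l * 4
leafSum l 1F = 2 + (1 + 2 * l) * 4
leafSum l 2F = 3 + l * 4

-- The where-clauses state the normal forms of the four-term arc sums, as the ring
-- solver does not normalise its goal.
pathHub-sum : ∀ s y →
  sumFin s (λ l → sumFin 4 (λ c → if ⌊ source (pathArc c) ≟ y ⌋ then suc (toℕ c + 4 * toℕ l) else 0)) ≡
  hubSum s y
pathHub-sum s 0F = trans (sumFin-cong s (λ l → out₀ (toℕ l))) (sumFin-*-odd s 2)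
  where
  out₀ : ∀ n → 2 + 4 * n + 0 ≡ 2 * (1 + 2 * n)
  out₀ = solve-∀
pathHub-sum s 1F = trans (sumFin-cong s (λ l → out₁ (toℕ l))) (sumFin-*-odd s 4)
  where
  out₁ : ∀ n → 1 + 4 * n + (3 + 4 * n + 0) ≡ 4 * (1 + 2 * n)
  out₁ = solve-∀
pathHub-sum s 2F = begin
  sumFin s (λ l → 4 + 4 * toℕ l + 0)                          ≡⟨ sumFin-cong s (λ l → out₂ (toℕ l)) ⟩
  sumFin s (λ l → 2 * (1 + 2 * toℕ l) + 2)                    ≡⟨ sumFin-+ s _ _ ⟩
  sumFin s (λ l → 2 * (1 + 2 * toℕ l)) + sumFin s (λ _ → 2)  ≡⟨ cong₂ _+_ (sumFin-*-odd s 2) (sumFin-const s 2) ⟩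
  2 * (s * s) + s * 2                                         ∎
  where
  open ≡-Reasoning
  out₂ : ∀ n → 4 + 4 * n + 0 ≡ 2 * (1 + 2 * n) + 2
  out₂ = solve-∀

pathLeaf-sum : ∀ l y →
  sumFin 4 (λ c → if ⌊ target (pathArc c) ≟ y ⌋ then suc (toℕ c + 4 * l) else 0) ≡ leafSum l y
pathLeaf-sum l 0F = in₀ l
  where
  in₀ : ∀ n → 1 + 4 * n + 0 ≡ 1 + n * 4
  in₀ = solve-∀
pathLeaf-sum l 1F = in₁ l
  where
  in₁ : ∀ n → 2 + 4 * n + (4 + 4 * n + 0) ≡ 2 + (1 + 2 * n) * 4
  in₁ = solve-∀
pathLeaf-sum l 2F = in₂ l
  where
  in₂ : ∀ n → 3 + 4 * n + 0 ≡ 3 + n * 4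
  in₂ = solve-∀

leafSum-injective : ∀ l l' y y' → leafSum l y ≡ leafSum l' y' → l ≡ l' × y ≡ y'
leafSum-injective l l' 0F 0F eq = *-cancelʳ-≡ l l' 4 (suc-injective eq) , refl
leafSum-injective l l' 1F 1F eq =
  *-cancelˡ-≡ l l' 2 (suc-injective (*-cancelʳ-≡ (1 + 2 * l) (1 + 2 * l') 4 (+-cancelˡ-≡ 2 _ _ eq))) , refl
leafSum-injective l l' 2F 2F eq = *-cancelʳ-≡ l l' 4 (+-cancelˡ-≡ 3 _ _ eq) , refl
leafSum-injective l l' 0F 1F eq = contradiction (m+kn≡o+ln⇒m%n≡o%n 1 l 2 (1 + 2 * l') 4 eq) λ ()
leafSum-injective l l' 0F 2F eq = contradiction (m+kn≡o+ln⇒m%n≡o%n 1 l 3 l' 4 eq) λ ()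
leafSum-injective l l' 1F 0F eq = contradiction (m+kn≡o+ln⇒m%n≡o%n 2 (1 + 2 * l) 1 l' 4 eq) λ ()
leafSum-injective l l' 1F 2F eq = contradiction (m+kn≡o+ln⇒m%n≡o%n 2 (1 + 2 * l) 3 l' 4 eq) λ ()
leafSum-injective l l' 2F 0F eq = contradiction (m+kn≡o+ln⇒m%n≡o%n 3 l 1 l' 4 eq) λ ()
leafSum-injective l l' 2F 1F eq = contradiction (m+kn≡o+ln⇒m%n≡o%n 3 l 2 (1 + 2 * l') 4 eq) λ ()

hubSum-injective : ∀ {s} → 2 ≤ s → ∀ y y' → hubSum s y ≡ hubSum s y' → y ≡ y'
hubSum-injective {s@(suc _)} 2≤s = injective
  where
  open ≤-Reasoning
  h₀<h₂ : hubSum s 0F < hubSum s 2F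
  h₀<h₂ = m<m+n (2 * (s * s)) z<s
  h₂<h₁ : hubSum s 2F < hubSum s 1F
  h₂<h₁ = begin-strict
    2 * (s * s) + s * 2       ≡⟨ cong (2 * (s * s) +_) (*-comm s 2) ⟩
    2 * (s * s) + 2 * s       <⟨ +-monoʳ-< (2 * (s * s)) (*-monoʳ-< 2 (m<m*n s s 2≤s)) ⟩
    2 * (s * s) + 2 * (s * s) ≡⟨ double (s * s) ⟩
    4 * (s * s)               ∎
    where
    double : ∀ m → 2 * m + 2 * m ≡ 4 * m
    double = solve-∀
  injective : ∀ y y' → hubSum s y ≡ hubSum s y' → y ≡ y'
  injective 0F 0F _ = refl
  injective 0F 1F eq = contradiction eq (<⇒≢ (<-trans h₀<h₂ h₂<h₁))
  injective 0F 2F eq = contradiction eq (<⇒≢ h₀<h₂)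
  injective 1F 0F eq = contradiction eq (>⇒≢ (<-trans h₀<h₂ h₂<h₁))
  injective 1F 1F _ = refl
  injective 1F 2F eq = contradiction eq (>⇒≢ h₂<h₁)
  injective 2F 0F eq = contradiction eq (>⇒≢ h₀<h₂)
  injective 2F 1F eq = contradiction eq (<⇒≢ h₂<h₁)
  injective 2F 2F _ = refl

2[s*s]≤hubSum : ∀ s y → 2 * (s * s) ≤ hubSum s y
2[s*s]≤hubSum s 0F = ≤-refl
2[s*s]≤hubSum s 1F = *-monoˡ-≤ (s * s) {2} {4} (s≤s (s≤s z≤n))
2[s*s]≤hubSum s 2F = m≤m+n (2 * (s * s)) (s * 2)

leafSum<8[1+l] : ∀ l y → leafSum l y < 8 * suc l
leafSum<8[1+l] l 0F = m+k≡n⇒m≤n (6 + l * 4) (gap₀ l)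
  where
  gap₀ : ∀ l → suc (1 + l * 4) + (6 + l * 4) ≡ 8 * suc l
  gap₀ = solve-∀
leafSum<8[1+l] l 1F = m+k≡n⇒m≤n 1 (gap₁ l)
  where
  gap₁ : ∀ l → suc (2 + (1 + 2 * l) * 4) + 1 ≡ 8 * suc l
  gap₁ = solve-∀
leafSum<8[1+l] l 2F = m+k≡n⇒m≤n (4 + l * 4) (gap₂ l)
  where
  gap₂ : ∀ l → suc (3 + l * 4) + (4 + l * 4) ≡ 8 * suc l
  gap₂ = solve-∀

leafSum<hubSum : ∀ {s l} → 4 ≤ s → l < s → ∀ y y' → leafSum l y < hubSum s y'
leafSum<hubSum {s} {l} 4≤s l<s y y' = begin-strict
  leafSum l y   <⟨ leafSum<8[1+l] l y ⟩
  8 * suc l     ≤⟨ *-monoʳ-≤ 8 l<s ⟩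
  8 * s         ≡⟨ *-assoc 2 4 s ⟩
  2 * (4 * s)   ≤⟨ *-monoʳ-≤ 2 (*-monoˡ-≤ s 4≤s) ⟩
  2 * (s * s)   ≤⟨ 2[s*s]≤hubSum s y' ⟩
  hubSum s y'   ∎
  where open ≤-Reasoning

leafSum≢hubSum? : ∀ s → Dec (∀ (l : Fin s) y y' → leafSum (toℕ l) y ≢ hubSum s y')
leafSum≢hubSum? s = all? λ l → all? λ y → all? λ y' → ¬? (leafSum (toℕ l) y ≟ℕ hubSum s y')

leafSum≢hubSum : ∀ {s} → 2 ≤ s → ∀ (l : Fin s) y y' → leafSum (toℕ l) y ≢ hubSum s y'
leafSum≢hubSum {1} (s≤s ())
leafSum≢hubSum {2} _ = from-yes (leafSum≢hubSum? 2)
leafSum≢hubSum {3} _ = from-yes (leafSum≢hubSum? 3)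
leafSum≢hubSum {suc (suc (suc (suc _)))} _ l y y' =
  <⇒≢ (leafSum<hubSum (s≤s (s≤s (s≤s (s≤s z≤n)))) (toℕ<n l) y y')

vertexValue : ∀ s → Fin (suc s) → Fin 3 → ℕ
vertexValue s zero    y = hubSum s y
vertexValue s (suc l) y = leafSum (toℕ l) y

vertexValue-injective : ∀ {s} → 2 ≤ s → ∀ {x y x' y'} →
                        vertexValue s x y ≡ vertexValue s x' y' → x ≡ x' × y ≡ y'
vertexValue-injective 2≤s {zero}  {y} {zero}   {y'} eq = refl , hubSum-injective 2≤s y y' eq
vertexValue-injective 2≤s {zero}  {y} {suc l'} {y'} eq = contradiction (sym eq) (leafSum≢hubSum 2≤s l' y' y)
vertexValue-injective 2≤s {suc l} {y} {zero}   {y'} eq = contradiction eq (leafSum≢hubSum 2≤s l y y')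
vertexValue-injective 2≤s {suc l} {y} {suc l'} {y'} eq
  with leafSum-injective (toℕ l) (toℕ l') y y' eq
... | l≡l' , y≡y' = cong suc (toℕ-injective l≡l') , y≡y'

lemma3p1 : (s : ℕ) → 2 ≤ s → Antimagic (Star s ×ᵍ Path 3)
lemma3p1 s 2≤s =
  s * 4 , labelling ,
  injective-via-combine (vertexSum (Star s ×ᵍ Path 3) (s * 4) labelling) (vertexValue s)
    vertexSum≡vertexValue (vertexValue-injective 2≤s)
  where
  labelling : Edge (Star s ×ᵍ Path 3) ↔ Fin (s * 4)
  labelling = starLabelling s (Path 3) pathArcs
  vertexSum≡vertexValue : ∀ x y → vertexSum (Star s ×ᵍ Path 3) (s * 4) labelling (combine x y) ≡ vertexValue s x y
  vertexSum≡vertexValue zero    y = trans (vertexSum-hub s (Path 3) pathArcs y) (pathHub-sum s y)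
  vertexSum≡vertexValue (suc l) y = trans (vertexSum-leaf s (Path 3) pathArcs l y) (pathLeaf-sum (toℕ l) y)
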